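{- For every natural number $n$: $\Sigma^\ast_n = \{A \mid \rho_\exists(A)\le n\}$ and $\Pi^\ast_n=\{A\mid\rho_\forall(A)\le n\}$. Consequently, for $n>0$, $\Delta^\ast_n=\{A\mid \rho_0(A)\le n\}$.
   Context: Formulas are built over a relational signature from atoms (class ${\sf AT}$, including $\top,\bot$) using $\neg,\wedge,\vee,\to,\exists,\forall$. $\Sigma^\ast_0=\Pi^\ast_0=\emptyset$; $\Sigma^\ast_{n+1},\Pi^\ast_{n+1}$ are the least classes with: ${\sf AT}$ in both; $\neg A\in\Sigma^\ast_{n+1}$ for $A\in\Pi^\ast_{n+1}$ and $\neg A\in\Pi^\ast_{n+1}$ for $A\in\Sigma^\ast_{n+1}$; each closed under $\wedge,\vee$ of its own members; $A\to B\in\Sigma^\ast_{n+1}$ for $A\in\Pi^\ast_{n+1},B\in\Sigma^\ast_{n+1}$, and $A\to B\in\Pi^\ast_{n+1}$ for $A\in\Sigma^\ast_{n+1},B\in\Pi^\ast_{n+1}$; $\exists vA\in\Sigma^\ast_{n+1}$ for $A\in\Sigma^\ast_{n+1}$, $\forall vA\in\Sigma^\ast_{n+1}$ for $A\in\Pi^\ast_n$; $\forall vA\in\Pi^\ast_{n+1}$ for $A\in\Pi^\ast_{n+1}$, $\exists vA\in\Pi^\ast_{n+1}$ for $A\in\Sigma^\ast_n$. $\Delta^\ast_{n+1}$ is the least class containing ${\sf AT}$, closed under $\neg,\wedge,\vee,\to$, containing $\exists vA$ for $A\in\Sigma^\ast_n$ and $\forall vA$ for $A\in\Pi^\ast_n$.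 The measures: atoms have $\rho_\exists=\rho_\forall=1$; $\rho_\exists(\neg B)=\rho_\forall(B)$, $\rho_\forall(\neg B)=\rho_\exists(B)$; for $\wedge,\vee$ each measure is the max of the same measure on components; $\rho_\exists(B\to C)=\max(\rho_\forall(B),\rho_\exists(C))$, $\rho_\forall(B\to C)=\max(\rho_\exists(B),\rho_\forall(C))$; $\rho_\exists(\exists vB)=\rho_\exists(B)$, $\rho_\forall(\exists vB)=\rho_\exists(B)+1$; $\rho_\exists(\forall vB)=\rho_\forall(B)+1$, $\rho_\forall(\forall vB)=\rho_\forall(B)$; $\rho_0=\max(\rho_\exists,\rho_\forall)$. -}

module Defs where

open import Data.Nat using (ℕ; zero; suc; _⊔_)

-- Formulas over a relational signature. Atomic formulas R(x̄) are abstracted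
-- as an arbitrary type At of atoms; ⊤ and ⊥ are also atoms. Variables are ℕ.
data Fm (At : Set) : Set where
  atom : At → Fm At
  ⊤'   : Fm At
  ⊥'   : Fm At
  ¬'_  : Fm At → Fm At
  _∧'_ : Fm At → Fm At → Fm At
  _∨'_ : Fm At → Fm At → Fm At
  _→'_ : Fm At → Fm At → Fm At
  ∃'   : ℕ → Fm At → Fm At
  ∀'   : ℕ → Fm At → Fm At

module _ {At : Set} where

  data IsAT : Fm At → Set where
    at-atom : ∀ a → IsAT (atom a)
    at-⊤    : IsAT ⊤'
    at-⊥    : IsAT ⊥'

  data Σ* : ℕ → Fm At → Set
  data Π* : ℕ → Fm At → Set

  data Σ* where
    s-at  : ∀ {n A} → IsAT A → Σ* (suc n) A
    s-¬   : ∀ {n A} → Π* (suc n) A → Σ* (suc n) (¬' A)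
    s-∧   : ∀ {n A B} → Σ* (suc n) A → Σ* (suc n) B → Σ* (suc n) (A ∧' B)
    s-∨   : ∀ {n A B} → Σ* (suc n) A → Σ* (suc n) B → Σ* (suc n) (A ∨' B)
    s-→   : ∀ {n A B} → Π* (suc n) A → Σ* (suc n) B → Σ* (suc n) (A →' B)
    s-∃   : ∀ {n v A} → Σ* (suc n) A → Σ* (suc n) (∃' v A)
    s-∀   : ∀ {n v A} → Π* n A → Σ* (suc n) (∀' v A)

  data Π* where
    p-at  : ∀ {n A} → IsAT A → Π* (suc n) A
    p-¬   : ∀ {n A} → Σ* (suc n) A → Π* (suc n) (¬' A)
    p-∧   : ∀ {n A B} → Π* (suc n) A → Π* (suc n) B → Π* (suc n) (A ∧' B)
    p-∨   : ∀ {n A B} → Π* (suc n) A → Π* (suc n) B → Π* (suc n) (A ∨' B)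
    p-→   : ∀ {n A B} → Σ* (suc n) A → Π* (suc n) B → Π* (suc n) (A →' B)
    p-∀   : ∀ {n v A} → Π* (suc n) A → Π* (suc n) (∀' v A)
    p-∃   : ∀ {n v A} → Σ* n A → Π* (suc n) (∃' v A)

  data Δ* : ℕ → Fm At → Set where
    d-at : ∀ {n A} → IsAT A → Δ* (suc n) A
    d-¬  : ∀ {n A} → Δ* (suc n) A → Δ* (suc n) (¬' A)
    d-∧  : ∀ {n A B} → Δ* (suc n) A → Δ* (suc n) B → Δ* (suc n) (A ∧' B)
    d-∨  : ∀ {n A B} → Δ* (suc n) A → Δ* (suc n) B → Δ* (suc n) (A ∨' B)
    d-→  : ∀ {n A B} → Δ* (suc n) A → Δ* (suc n) B → Δ* (suc n) (A →' B)
    d-∃  : ∀ {n v A} → Σ* n A → Δ* (suc n) (∃' v A)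
    d-∀  : ∀ {n v A} → Π* n A → Δ* (suc n) (∀' v A)

  ρ∃ ρ∀ : Fm At → ℕ
  ρ∃ (atom _) = 1
  ρ∃ ⊤' = 1
  ρ∃ ⊥' = 1
  ρ∃ (¬' B) = ρ∀ B
  ρ∃ (B ∧' C) = ρ∃ B ⊔ ρ∃ C
  ρ∃ (B ∨' C) = ρ∃ B ⊔ ρ∃ C
  ρ∃ (B →' C) = ρ∀ B ⊔ ρ∃ C
  ρ∃ (∃' _ B) = ρ∃ B
  ρ∃ (∀' _ B) = suc (ρ∀ B)
  ρ∀ (atom _) = 1
  ρ∀ ⊤' = 1
  ρ∀ ⊥' = 1
  ρ∀ (¬' B) = ρ∃ B
  ρ∀ (B ∧' C) = ρ∀ B ⊔ ρ∀ C
  ρ∀ (B ∨' C) = ρ∀ B ⊔ ρ∀ C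
  ρ∀ (B →' C) = ρ∃ B ⊔ ρ∀ C
  ρ∀ (∃' _ B) = suc (ρ∃ B)
  ρ∀ (∀' _ B) = ρ∀ B

  ρ₀ : Fm At → ℕ
  ρ₀ A = ρ∃ A ⊔ ρ∀ A

-- Each formation rule of Σ*/Π* mirrors the clause of ρ∃/ρ∀ for the same
-- connective, the level dropping by one exactly where a quantifier changes
-- polarity (∀ inside Σ*, ∃ inside Π*), where the measure grows by one. Level 0 is empty on both sides
-- because every formula has measure at least 1.
module Submission where

open import Defs
open import Data.Nat using (ℕ; zero; suc; _≤_; _<_; _>_; z≤n; s≤s; s≤s⁻¹)
open import Data.Nat.Properties using (⊔-lub; m⊔n≤o⇒m≤o; m⊔n≤o⇒n≤o; m≤n⇒m≤n⊔o; m≤n⇒m≤1+n; <⇒≱)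
open import Data.Product using (_×_; _,_; uncurry)
open import Function.Bundles using (_⇔_; mk⇔)
open import Relation.Nullary using (contradiction)

module _ {At : Set} where

  0<ρ∃ : (A : Fm At) → 0 < ρ∃ A
  0<ρ∀ : (A : Fm At) → 0 < ρ∀ A
  0<ρ∃ (atom _)  = s≤s z≤n
  0<ρ∃ ⊤'        = s≤s z≤n
  0<ρ∃ ⊥'        = s≤s z≤n
  0<ρ∃ (¬' A)    = 0<ρ∀ A
  0<ρ∃ (A ∧' _)  = m≤n⇒m≤n⊔o _ (0<ρ∃ A)
  0<ρ∃ (A ∨' _)  = m≤n⇒m≤n⊔o _ (0<ρ∃ A)
  0<ρ∃ (A →' _)  = m≤n⇒m≤n⊔o _ (0<ρ∀ A)
  0<ρ∃ (∃' _ A)  = 0<ρ∃ A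
  0<ρ∃ (∀' _ _)  = s≤s z≤n
  0<ρ∀ (atom _)  = s≤s z≤n
  0<ρ∀ ⊤'        = s≤s z≤n
  0<ρ∀ ⊥'        = s≤s z≤n
  0<ρ∀ (¬' A)    = 0<ρ∃ A
  0<ρ∀ (A ∧' _)  = m≤n⇒m≤n⊔o _ (0<ρ∀ A)
  0<ρ∀ (A ∨' _)  = m≤n⇒m≤n⊔o _ (0<ρ∀ A)
  0<ρ∀ (A →' _)  = m≤n⇒m≤n⊔o _ (0<ρ∃ A)
  0<ρ∀ (∃' _ _)  = s≤s z≤n
  0<ρ∀ (∀' _ A)  = 0<ρ∀ A

  IsAT⇒ρ∃≤1+n : ∀ {n} {A : Fm At} → IsAT A → ρ∃ A ≤ suc n
  IsAT⇒ρ∃≤1+n (at-atom _) = s≤s z≤n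
  IsAT⇒ρ∃≤1+n at-⊤        = s≤s z≤n
  IsAT⇒ρ∃≤1+n at-⊥        = s≤s z≤n

  IsAT⇒ρ∀≤1+n : ∀ {n} {A : Fm At} → IsAT A → ρ∀ A ≤ suc n
  IsAT⇒ρ∀≤1+n (at-atom _) = s≤s z≤n
  IsAT⇒ρ∀≤1+n at-⊤        = s≤s z≤n
  IsAT⇒ρ∀≤1+n at-⊥        = s≤s z≤n

  Σ*⇒ρ∃≤ : ∀ {n} {A : Fm At} → Σ* n A → ρ∃ A ≤ n
  Π*⇒ρ∀≤ : ∀ {n} {A : Fm At} → Π* n A → ρ∀ A ≤ n
  Σ*⇒ρ∃≤ (s-at a)  = IsAT⇒ρ∃≤1+n a
  Σ*⇒ρ∃≤ (s-¬ p)   = Π*⇒ρ∀≤ p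
  Σ*⇒ρ∃≤ (s-∧ p q) = ⊔-lub (Σ*⇒ρ∃≤ p) (Σ*⇒ρ∃≤ q)
  Σ*⇒ρ∃≤ (s-∨ p q) = ⊔-lub (Σ*⇒ρ∃≤ p) (Σ*⇒ρ∃≤ q)
  Σ*⇒ρ∃≤ (s-→ p q) = ⊔-lub (Π*⇒ρ∀≤ p) (Σ*⇒ρ∃≤ q)
  Σ*⇒ρ∃≤ (s-∃ p)   = Σ*⇒ρ∃≤ p
  Σ*⇒ρ∃≤ (s-∀ p)   = s≤s (Π*⇒ρ∀≤ p)
  Π*⇒ρ∀≤ (p-at a)  = IsAT⇒ρ∀≤1+n a
  Π*⇒ρ∀≤ (p-¬ p)   = Σ*⇒ρ∃≤ p
  Π*⇒ρ∀≤ (p-∧ p q) = ⊔-lub (Π*⇒ρ∀≤ p) (Π*⇒ρ∀≤ q)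
  Π*⇒ρ∀≤ (p-∨ p q) = ⊔-lub (Π*⇒ρ∀≤ p) (Π*⇒ρ∀≤ q)
  Π*⇒ρ∀≤ (p-→ p q) = ⊔-lub (Σ*⇒ρ∃≤ p) (Π*⇒ρ∀≤ q)
  Π*⇒ρ∀≤ (p-∀ p)   = Π*⇒ρ∀≤ p
  Π*⇒ρ∀≤ (p-∃ p)   = s≤s (Σ*⇒ρ∃≤ p)

  ρ∃≤⇒Σ* : ∀ {n} (A : Fm At) → ρ∃ A ≤ n → Σ* n A
  ρ∀≤⇒Π* : ∀ {n} (A : Fm At) → ρ∀ A ≤ n → Π* n A
  ρ∃≤⇒Σ* {zero}  A        h = contradiction h (<⇒≱ (0<ρ∃ A))
  ρ∃≤⇒Σ* {suc _} (atom a) _ = s-at (at-atom a)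
  ρ∃≤⇒Σ* {suc _} ⊤'       _ = s-at at-⊤
  ρ∃≤⇒Σ* {suc _} ⊥'       _ = s-at at-⊥
  ρ∃≤⇒Σ* {suc _} (¬' A)   h = s-¬ (ρ∀≤⇒Π* A h)
  ρ∃≤⇒Σ* {suc _} (A ∧' B) h = s-∧ (ρ∃≤⇒Σ* A (m⊔n≤o⇒m≤o _ _ h)) (ρ∃≤⇒Σ* B (m⊔n≤o⇒n≤o _ _ h))
  ρ∃≤⇒Σ* {suc _} (A ∨' B) h = s-∨ (ρ∃≤⇒Σ* A (m⊔n≤o⇒m≤o _ _ h)) (ρ∃≤⇒Σ* B (m⊔n≤o⇒n≤o _ _ h))
  ρ∃≤⇒Σ* {suc _} (A →' B) h = s-→ (ρ∀≤⇒Π* A (m⊔n≤o⇒m≤o _ _ h)) (ρ∃≤⇒Σ* B (m⊔n≤o⇒n≤o _ _ h))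
  ρ∃≤⇒Σ* {suc _} (∃' _ A) h = s-∃ (ρ∃≤⇒Σ* A h)
  ρ∃≤⇒Σ* {suc _} (∀' _ A) h = s-∀ (ρ∀≤⇒Π* A (s≤s⁻¹ h))
  ρ∀≤⇒Π* {zero}  A        h = contradiction h (<⇒≱ (0<ρ∀ A))
  ρ∀≤⇒Π* {suc _} (atom a) _ = p-at (at-atom a)
  ρ∀≤⇒Π* {suc _} ⊤'       _ = p-at at-⊤
  ρ∀≤⇒Π* {suc _} ⊥'       _ = p-at at-⊥
  ρ∀≤⇒Π* {suc _} (¬' A)   h = p-¬ (ρ∃≤⇒Σ* A h)
  ρ∀≤⇒Π* {suc _} (A ∧' B) h = p-∧ (ρ∀≤⇒Π* A (m⊔n≤o⇒m≤o _ _ h)) (ρ∀≤⇒Π* B (m⊔n≤o⇒n≤o _ _ h))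
  ρ∀≤⇒Π* {suc _} (A ∨' B) h = p-∨ (ρ∀≤⇒Π* A (m⊔n≤o⇒m≤o _ _ h)) (ρ∀≤⇒Π* B (m⊔n≤o⇒n≤o _ _ h))
  ρ∀≤⇒Π* {suc _} (A →' B) h = p-→ (ρ∃≤⇒Σ* A (m⊔n≤o⇒m≤o _ _ h)) (ρ∀≤⇒Π* B (m⊔n≤o⇒n≤o _ _ h))
  ρ∀≤⇒Π* {suc _} (∀' _ A) h = p-∀ (ρ∀≤⇒Π* A h)
  ρ∀≤⇒Π* {suc _} (∃' _ A) h = p-∃ (ρ∃≤⇒Σ* A (s≤s⁻¹ h))

  Σ*⇔ρ∃≤ : ∀ n (A : Fm At) → Σ* n A ⇔ ρ∃ A ≤ n
  Σ*⇔ρ∃≤ _ A = mk⇔ Σ*⇒ρ∃≤ (ρ∃≤⇒Σ* A)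

  Π*⇔ρ∀≤ : ∀ n (A : Fm At) → Π* n A ⇔ ρ∀ A ≤ n
  Π*⇔ρ∀≤ _ A = mk⇔ Π*⇒ρ∀≤ (ρ∀≤⇒Π* A)

  -- ρ₀ is not compositional (ρ₀ (¬' A) is not ρ₀ A), so Δ* is related to the
  -- pair of measures ρ∃, ρ∀ instead.
  Δ*⇒ρ∃≤×ρ∀≤ : ∀ {n} {A : Fm At} → Δ* n A → ρ∃ A ≤ n × ρ∀ A ≤ n
  Δ*⇒ρ∃≤×ρ∀≤ (d-at a) = IsAT⇒ρ∃≤1+n a , IsAT⇒ρ∀≤1+n a
  Δ*⇒ρ∃≤×ρ∀≤ (d-¬ p) with Δ*⇒ρ∃≤×ρ∀≤ p
  ... | e , u = u , e
  Δ*⇒ρ∃≤×ρ∀≤ (d-∧ p q) with Δ*⇒ρ∃≤×ρ∀≤ p | Δ*⇒ρ∃≤×ρ∀≤ q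
  ... | e₁ , u₁ | e₂ , u₂ = ⊔-lub e₁ e₂ , ⊔-lub u₁ u₂
  Δ*⇒ρ∃≤×ρ∀≤ (d-∨ p q) with Δ*⇒ρ∃≤×ρ∀≤ p | Δ*⇒ρ∃≤×ρ∀≤ q
  ... | e₁ , u₁ | e₂ , u₂ = ⊔-lub e₁ e₂ , ⊔-lub u₁ u₂
  Δ*⇒ρ∃≤×ρ∀≤ (d-→ p q) with Δ*⇒ρ∃≤×ρ∀≤ p | Δ*⇒ρ∃≤×ρ∀≤ q
  ... | e₁ , u₁ | e₂ , u₂ = ⊔-lub u₁ e₂ , ⊔-lub e₁ u₂
  Δ*⇒ρ∃≤×ρ∀≤ (d-∃ p) = m≤n⇒m≤1+n (Σ*⇒ρ∃≤ p) , s≤s (Σ*⇒ρ∃≤ p)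
  Δ*⇒ρ∃≤×ρ∀≤ (d-∀ p) = s≤s (Π*⇒ρ∀≤ p) , m≤n⇒m≤1+n (Π*⇒ρ∀≤ p)

  ρ∃≤×ρ∀≤⇒Δ* : ∀ {n} (A : Fm At) → ρ∃ A ≤ suc n → ρ∀ A ≤ suc n → Δ* (suc n) A
  ρ∃≤×ρ∀≤⇒Δ* (atom a) _ _ = d-at (at-atom a)
  ρ∃≤×ρ∀≤⇒Δ* ⊤'       _ _ = d-at at-⊤
  ρ∃≤×ρ∀≤⇒Δ* ⊥'       _ _ = d-at at-⊥
  ρ∃≤×ρ∀≤⇒Δ* (¬' A)   e u = d-¬ (ρ∃≤×ρ∀≤⇒Δ* A u e)
  ρ∃≤×ρ∀≤⇒Δ* (A ∧' B) e u =
    d-∧ (ρ∃≤×ρ∀≤⇒Δ* A (m⊔n≤o⇒m≤o _ _ e) (m⊔n≤o⇒m≤o _ _ u))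
        (ρ∃≤×ρ∀≤⇒Δ* B (m⊔n≤o⇒n≤o _ _ e) (m⊔n≤o⇒n≤o _ _ u))
  ρ∃≤×ρ∀≤⇒Δ* (A ∨' B) e u =
    d-∨ (ρ∃≤×ρ∀≤⇒Δ* A (m⊔n≤o⇒m≤o _ _ e) (m⊔n≤o⇒m≤o _ _ u))
        (ρ∃≤×ρ∀≤⇒Δ* B (m⊔n≤o⇒n≤o _ _ e) (m⊔n≤o⇒n≤o _ _ u))
  ρ∃≤×ρ∀≤⇒Δ* (A →' B) e u =
    d-→ (ρ∃≤×ρ∀≤⇒Δ* A (m⊔n≤o⇒m≤o _ _ u) (m⊔n≤o⇒m≤o _ _ e))
        (ρ∃≤×ρ∀≤⇒Δ* B (m⊔n≤o⇒n≤o _ _ e) (m⊔n≤o⇒n≤o _ _ u))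
  ρ∃≤×ρ∀≤⇒Δ* (∃' _ A) _ u = d-∃ (ρ∃≤⇒Σ* A (s≤s⁻¹ u))
  ρ∃≤×ρ∀≤⇒Δ* (∀' _ A) e _ = d-∀ (ρ∀≤⇒Π* A (s≤s⁻¹ e))

  Δ*⇔ρ₀≤ : ∀ n → n > 0 → (A : Fm At) → Δ* n A ⇔ ρ₀ A ≤ n
  Δ*⇔ρ₀≤ (suc _) _ A = mk⇔
    (λ d → uncurry ⊔-lub (Δ*⇒ρ∃≤×ρ∀≤ d))
    (λ h → ρ∃≤×ρ∀≤⇒Δ* A (m⊔n≤o⇒m≤o _ _ h) (m⊔n≤o⇒n≤o _ _ h))

mainTheorem19 : (At : Set) →
    ((n : ℕ) → (A : Fm At) → (Σ* n A ⇔ ρ∃ A ≤ n) × (Π* n A ⇔ ρ∀ A ≤ n))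
    × ((n : ℕ) → n > 0 → (A : Fm At) → (Δ* n A ⇔ ρ₀ A ≤ n))
mainTheorem19 _ = (λ n A → Σ*⇔ρ∃≤ n A , Π*⇔ρ∀≤ n A) , Δ*⇔ρ₀≤
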